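{- Let $B$ be a rectangular $m \times n$ board in the square grid (with $mn \ge 2$). Then $d(B) = mn - \gamma(G_{m,n})$.
   Context: Work in the square grid: cells are unit squares with integer corners, and two cells are neighbors if they share an edge. A domino is a set of two adjacent cells. A domino covering of a board $B$ is a finite collection (repetitions allowed) of dominoes, each contained in $B$, whose union is $B$; it is saturated if removing any single domino leaves some cell uncovered. $d(B)$ is the largest number of dominoes in a saturated domino covering of $B$. The grid graph $G_{m,n}$ is the adjacency graph of the $m\times n$ rectangle: vertices are its $mn$ cells, two joined if they are neighbors. $\gamma(G)$ denotes the domination number of a graph $G$: the minimum size of a set $S$ of vertices such that every vertex lies in $S$ or is adjacent to a vertex of $S$. -}

module Defs where

open import Data.Nat using (ℕ; suc; _≤_; _≥_)
open import Data.Fin using (Fin; toℕ)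
open import Data.Product using (_×_; _,_; proj₁; proj₂; Σ; ∃)
open import Data.Sum using (_⊎_)
open import Data.List using (List; length; removeAt)
open import Data.List.Relation.Unary.All using (All)
open import Data.List.Relation.Unary.Any using (Any)
open import Data.List.Relation.Unary.Unique.Propositional using (Unique)
open import Relation.Binary.PropositionalEquality using (_≡_)
open import Relation.Nullary using (¬_)

Cell : ℕ → ℕ → Set
Cell m n = Fin m × Fin n

Consecutive : ℕ → ℕ → Set
Consecutive a b = suc a ≡ b ⊎ suc b ≡ a

Adjacent : ∀ {m n} → Cell m n → Cell m n → Set
Adjacent (i , j) (i' , j') =
  (i ≡ i' × Consecutive (toℕ j) (toℕ j')) ⊎ (j ≡ j' × Consecutive (toℕ i) (toℕ i'))

Domino : ℕ → ℕ → Set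
Domino m n = Σ (Cell m n × Cell m n) λ p → Adjacent (proj₁ p) (proj₂ p)

_∈D_ : ∀ {m n} → Cell m n → Domino m n → Set
c ∈D ((a , b) , _) = c ≡ a ⊎ c ≡ b

-- A finite collection (repetitions allowed) of dominoes is a list.
-- The cell c is covered by the collection D.
Covered : ∀ {m n} → List (Domino m n) → Cell m n → Set
Covered D c = Any (c ∈D_) D

IsCovering : ∀ {m n} → List (Domino m n) → Set
IsCovering {m} {n} D = (c : Cell m n) → Covered D c

IsSaturated : ∀ {m n} → List (Domino m n) → Set
IsSaturated {m} {n} D =
  IsCovering D ×
  ((k : Fin (length D)) → ∃ λ (c : Cell m n) → ¬ Covered (removeAt D k) c)

IsMaxSaturatedSize : ℕ → ℕ → ℕ → Set
IsMaxSaturatedSize m n k =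
  (∃ λ (D : List (Domino m n)) → IsSaturated D × length D ≡ k) ×
  ((D : List (Domino m n)) → IsSaturated D → length D ≤ k)

IsDominating : ∀ {m n} → List (Cell m n) → Set
IsDominating {m} {n} S =
  Unique S ×
  ((c : Cell m n) → Any (λ s → c ≡ s ⊎ Adjacent c s) S)

IsDominationNumber : ℕ → ℕ → ℕ → Set
IsDominationNumber m n g =
  (∃ λ (S : List (Cell m n)) → IsDominating S × length S ≡ g) ×
  ((S : List (Cell m n)) → IsDominating S → g ≤ length S)

-- In a saturated covering every domino owns a private cell, covered by no other domino.
-- Distinct dominoes own distinct private cells, and the cells private to no domino form a
-- dominating set, since the partner of a private cell in its domino is not private; hence
-- d(B) ≤ mn − γ. Conversely, sending every cell outside a minimum dominating set to a
-- neighbour in it gives a spanning star forest with at most γ centres. A centre without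
-- leaves is removed by a local move that does not create centres: attach it to an adjacent
-- centre, move an adjacent leaf over to it, or let an adjacent leaf take over its own
-- one-leaf star. When every centre has a leaf, the dominoes joining each leaf to its centre
-- form a saturated covering with mn − #centres ≥ mn − γ dominoes.

module Submission where

open import Defs
open import Data.Empty using (⊥-elim)
open import Data.Fin using (Fin; zero; suc; toℕ; inject₁; combine; remQuot)
import Data.Fin.Properties as Fin
open import Data.List using (List; []; _∷_; length; lookup; filter; map; removeAt; tabulate; _++_)
open import Data.List.Properties using (length-map; length-tabulate; length-++)
import Data.List.Relation.Unary.All as All
open import Data.List.Relation.Unary.AllPairs using (_∷_)
open import Data.List.Relation.Unary.Any using (Any; here; there; index; any?)
open import Data.List.Relation.Unary.Any.Properties using (lookup-index)
open import Data.List.Relation.Unary.Unique.Propositional using (Unique)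
import Data.List.Relation.Unary.Unique.Propositional.Properties as Unique
open import Data.List.Relation.Binary.Subset.Propositional using (_⊆_)
open import Data.List.Membership.Propositional using (_∈_; _∉_; find; lose)
open import Data.List.Membership.Propositional.Properties
  using (∈-lookup; ∈-map⁻; ∈-filter⁺; ∈-filter⁻; ∈-tabulate⁺; ∈-tabulate⁻)
import Data.List.Membership.DecPropositional as DecMembership
open import Data.Nat using (ℕ; zero; suc; _+_; _*_; _∸_; _≤_; _<_; z≤n; s≤s)
open import Data.Nat.Properties
  using (module ≤-Reasoning; ≤-refl; ≤-trans; ≤-antisym; <-≤-trans; +-suc; +-monoʳ-≤; *-identityˡ;
         1+n≢n; m+n≤o⇒m≤o∸n; m+n∸n≡m; ∸-monoʳ-≤)
open import Data.Nat.Induction using (<-wellFounded)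
open import Induction.WellFounded using (Acc; acc)
open import Data.Product using (_×_; _,_; proj₁; proj₂; ∃; uncurry)
open import Data.Product.Properties using (≡-dec)
open import Data.Sum using (_⊎_; inj₁; inj₂; swap)
open import Function using (id; _∘_)
open import Level using (0ℓ)
open import Relation.Binary using (Rel; Symmetric; DecidableEquality)
open import Relation.Binary.PropositionalEquality
open import Relation.Nullary using (¬_; Dec; yes; no; ¬?)
open import Relation.Nullary.Decidable using (map′; _×-dec_; decidable-stable)
open import Relation.Unary using (Pred; Decidable)

module _ {a} {A : Set a} where

  lookup-injective : {xs : List A} → Unique xs → ∀ {i j} → lookup xs i ≡ lookup xs j → i ≡ j
  lookup-injective (_ ∷ _) {zero} {zero} _ = refl
  lookup-injective (x∉xs ∷ _) {zero} {suc j} eq = ⊥-elim (All.lookup x∉xs (∈-lookup j) eq)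
  lookup-injective (x∉xs ∷ _) {suc i} {zero} eq = ⊥-elim (All.lookup x∉xs (∈-lookup i) (sym eq))
  lookup-injective (_ ∷ xs!) {suc i} {suc j} eq = cong suc (lookup-injective xs! eq)

  Unique⇒length≤ : {xs ys : List A} → Unique xs → xs ⊆ ys → length xs ≤ length ys
  Unique⇒length≤ {xs} {ys} xs! xs⊆ys = Fin.injective⇒≤ position-injective
    where
    position : Fin (length xs) → Fin (length ys)
    position i = index (xs⊆ys (∈-lookup i))

    position-injective : ∀ {i j} → position i ≡ position j → i ≡ j
    position-injective {i} {j} eq = lookup-injective xs! (begin
      lookup xs i             ≡⟨ lookup-index (xs⊆ys (∈-lookup i)) ⟩
      lookup ys (position i)  ≡⟨ cong (lookup ys) eq ⟩
      lookup ys (position j)  ≡⟨ lookup-index (xs⊆ys (∈-lookup j)) ⟨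
      lookup xs j             ∎)
      where open ≡-Reasoning

  Any-removeAt⁺ : ∀ {p} {P : Pred A p} xs {j k : Fin (length xs)} →
                  P (lookup xs j) → j ≢ k → Any P (removeAt xs k)
  Any-removeAt⁺ (x ∷ xs) {zero}  {zero}  _   j≢k = ⊥-elim (j≢k refl)
  Any-removeAt⁺ (x ∷ xs) {zero}  {suc k} px  _   = here px
  Any-removeAt⁺ (x ∷ xs) {suc j} {zero}  pxj _   = lose (∈-lookup j) pxj
  Any-removeAt⁺ (x ∷ xs) {suc j} {suc k} pxj j≢k = there (Any-removeAt⁺ xs pxj (j≢k ∘ cong suc))

module FiniteEnumeration {V : Set} (vertices : List V) (∈-vertices : ∀ x → x ∈ vertices)
                   (vertices-unique : Unique vertices) where

  size : {P : Pred V 0ℓ} → Decidable P → ℕ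
  size P? = length (filter P? vertices)

  ∈-filter⇒ : {P : Pred V 0ℓ} (P? : Decidable P) → ∀ {x} → x ∈ filter P? vertices → P x
  ∈-filter⇒ P? = proj₂ ∘ ∈-filter⁻ P? {xs = vertices}

  exists? : {P : Pred V 0ℓ} → Decidable P → Dec (∃ P)
  exists? P? = map′ (λ some → let (x , _ , px) = find some in x , px)
                    (λ (x , px) → lose (∈-vertices x) px)
                    (any? P? vertices)

  module _ {P Q : Pred V 0ℓ} (P? : Decidable P) (Q? : Decidable Q) where

    size-≤-injective : (h : V → V) → (∀ {x y} → h x ≡ h y → x ≡ y) →
                       (∀ {x} → P x → Q (h x)) → size P? ≤ size Q?
    size-≤-injective h h-injective P⇒Q = begin
      size P?                             ≡⟨ length-map h (filter P? vertices) ⟨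
      length (map h (filter P? vertices)) ≤⟨ Unique⇒length≤ unique image⊆ ⟩
      size Q?                             ∎
      where
      open ≤-Reasoning
      unique : Unique (map h (filter P? vertices))
      unique = Unique.map⁺ h-injective (Unique.filter⁺ P? vertices-unique)
      image⊆ : map h (filter P? vertices) ⊆ filter Q? vertices
      image⊆ y∈ with ∈-map⁻ h y∈
      ... | x , x∈ , refl = ∈-filter⁺ Q? (∈-vertices (h x)) (P⇒Q (∈-filter⇒ P? x∈))

    size-< : (s : V) → (∀ {x} → P x → Q x × x ≢ s) → Q s → size P? < size Q?
    size-< s P⇒Q Qs = Unique⇒length≤ unique sub
      where
      unique : Unique (s ∷ filter P? vertices)
      unique = All.tabulate (λ x∈ → proj₂ (P⇒Q (∈-filter⇒ P? x∈)) ∘ sym)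
             ∷ Unique.filter⁺ P? vertices-unique
      sub : s ∷ filter P? vertices ⊆ filter Q? vertices
      sub (here refl) = ∈-filter⁺ Q? (∈-vertices s) Qs
      sub (there x∈) = ∈-filter⁺ Q? (∈-vertices _) (proj₁ (P⇒Q (∈-filter⇒ P? x∈)))

  size-≤-length : {P : Pred V 0ℓ} (P? : Decidable P) (S : List V) → (∀ {x} → P x → x ∈ S) →
                  size P? ≤ length S
  size-≤-length P? S P⊆S = Unique⇒length≤ (Unique.filter⁺ P? vertices-unique)
                                          (P⊆S ∘ ∈-filter⇒ P?)

module StarForests {V : Set} (_≟_ : DecidableEquality V)
                   (vertices : List V) (∈-vertices : ∀ x → x ∈ vertices) (vertices-unique : Unique vertices)
                   (_~_ : Rel V 0ℓ) (~-sym : Symmetric _~_) (~⇒≢ : ∀ {x y} → x ~ y → x ≢ y) where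

  open FiniteEnumeration vertices ∈-vertices vertices-unique
  open DecMembership _≟_ using (_∈?_)

  update : (V → V) → V → V → V → V
  update f x v y with y ≟ x
  ... | yes _ = v
  ... | no _ = f y

  update-≡ : ∀ f x v → update f x v x ≡ v
  update-≡ f x v with x ≟ x
  ... | yes _ = refl
  ... | no x≢x = ⊥-elim (x≢x refl)

  update-≢ : ∀ f {x} v {y} → y ≢ x → update f x v y ≡ f y
  update-≢ f {x} v {y} y≢x with y ≟ x
  ... | yes y≡x = ⊥-elim (y≢x y≡x)
  ... | no _ = refl

  transpose : V → V → V → V
  transpose a b = update (update id a b) b a

  transpose-a : ∀ a b → transpose a b a ≡ b
  transpose-a a b = by-cases (a ≟ b)
    where
    by-cases : Dec (a ≡ b) → transpose a b a ≡ b
    by-cases (yes refl) = update-≡ _ a a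
    by-cases (no a≢b) = trans (update-≢ _ a a≢b) (update-≡ id a b)

  transpose-b : ∀ a b → transpose a b b ≡ a
  transpose-b a b = update-≡ _ b a

  transpose-≢ : ∀ {a b x} → x ≢ a → x ≢ b → transpose a b x ≡ x
  transpose-≢ {a} {b} x≢a x≢b = trans (update-≢ _ a x≢b) (update-≢ id b x≢a)

  transpose-involutive : ∀ a b x → transpose a b (transpose a b x) ≡ x
  transpose-involutive a b x = by-cases (x ≟ a) (x ≟ b)
    where
    by-cases : Dec (x ≡ a) → Dec (x ≡ b) → transpose a b (transpose a b x) ≡ x
    by-cases (yes refl) _ = trans (cong (transpose x b) (transpose-a x b)) (transpose-b x b)
    by-cases (no _) (yes refl) = trans (cong (transpose a x) (transpose-b a x)) (transpose-a a x)
    by-cases (no x≢a) (no x≢b) = trans (cong (transpose a b) (transpose-≢ x≢a x≢b)) (transpose-≢ x≢a x≢b)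

  transpose-injective : ∀ a b {x y} → transpose a b x ≡ transpose a b y → x ≡ y
  transpose-injective a b {x} {y} eq =
    trans (sym (transpose-involutive a b x)) (trans (cong (transpose a b) eq) (transpose-involutive a b y))

  -- A map f encodes a spanning star forest: its fixed points are the centres, and every
  -- other vertex (a leaf) is sent to an adjacent centre.
  IsStarForest : (V → V) → Set
  IsStarForest f = ∀ x → f x ≢ x → f (f x) ≡ f x × x ~ f x

  Centre : (V → V) → Pred V 0ℓ
  Centre f x = f x ≡ x

  HasLeaf : (V → V) → Pred V 0ℓ
  HasLeaf f x = ∃ λ p → p ≢ x × f p ≡ x

  IsolatedCentre : (V → V) → Pred V 0ℓ
  IsolatedCentre f x = Centre f x × ¬ HasLeaf f x

  hasLeaf? : (f : V → V) → Decidable (HasLeaf f)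
  hasLeaf? f x = exists? λ p → ¬? (p ≟ x) ×-dec (f p ≟ x)

  isolatedCentre? : (f : V → V) → Decidable (IsolatedCentre f)
  isolatedCentre? f x = (f x ≟ x) ×-dec ¬? (hasLeaf? f x)

  centres : (V → V) → ℕ
  centres f = size (λ x → f x ≟ x)

  isolatedCentres : (V → V) → ℕ
  isolatedCentres f = size (isolatedCentre? f)

  leaf⇒¬HasLeaf : ∀ {f t} → IsStarForest f → ¬ Centre f t → ¬ HasLeaf f t
  leaf⇒¬HasLeaf {f} forest t-leaf (p , p≢t , fp≡t) =
    t-leaf (subst (Centre f) fp≡t (proj₁ (forest p λ fp≡p → p≢t (trans (sym fp≡p) fp≡t))))

  update-starForest : ∀ {f x v} → IsStarForest f → ¬ HasLeaf f x →
                      (v ≢ x → Centre f v × x ~ v) → IsStarForest (update f x v)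
  update-starForest {f} {x} {v} forest noLeaf attach y f′y≢y = by-cases (y ≟ x)
    where
    f′ = update f x v
    StarAt : V → Set
    StarAt z = f′ z ≡ z × y ~ z

    by-cases : Dec (y ≡ x) → StarAt (f′ y)
    by-cases (yes refl) = subst StarAt (sym (update-≡ f y v))
                            (trans (update-≢ f v v≢y) (proj₁ (attach v≢y)) , proj₂ (attach v≢y))
      where
      v≢y : v ≢ y
      v≢y v≡y = f′y≢y (trans (update-≡ f y v) v≡y)
    by-cases (no y≢x) = subst StarAt (sym (update-≢ f v y≢x))
                          (trans (update-≢ f v fy≢x) (proj₁ (forest y fy≢y)) , proj₂ (forest y fy≢y))
      where
      fy≢y : f y ≢ y
      fy≢y fy≡y = f′y≢y (trans (update-≢ f v y≢x) fy≡y)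
      fy≢x : f y ≢ x
      fy≢x fy≡x = noLeaf (y , y≢x , fy≡x)

  update-centre⁻ : ∀ {f x v y} → v ≢ x → Centre (update f x v) y → Centre f y
  update-centre⁻ {f} {x} {v} {y} v≢x centre =
    trans (sym (update-≢ f v λ { refl → v≢x (trans (sym (update-≡ f y v)) centre) })) centre

  update-isolatedCentre⁻ : ∀ {f x v y} → IsolatedCentre (update f x v) y → y ≢ x → y ≢ f x →
                           IsolatedCentre f y
  update-isolatedCentre⁻ {f} {x} {v} (centre , noLeaf) y≢x y≢fx =
    trans (sym (update-≢ f v y≢x)) centre ,
    λ (p , p≢y , fp≡y) → noLeaf (p , p≢y ,
      trans (update-≢ f v λ p≡x → y≢fx (trans (sym fp≡y) (cong f p≡x))) fp≡y)

  update-isolatedCentre⁺ : ∀ {f x v y} → IsolatedCentre f y → y ≢ x → v ≢ y →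
                           IsolatedCentre (update f x v) y
  update-isolatedCentre⁺ {f} {x} {v} (centre , noLeaf) y≢x v≢y =
    trans (update-≢ f v y≢x) centre ,
    λ (p , p≢y , f′p≡y) → noLeaf (p , p≢y ,
      trans (sym (update-≢ f v λ { refl → v≢y (trans (sym (update-≡ f p v)) f′p≡y) })) f′p≡y)

  Improvement : (V → V) → Set
  Improvement f = ∃ λ f′ → IsStarForest f′ × centres f′ ≤ centres f × isolatedCentres f′ < isolatedCentres f

  module _ {f s t} (forest : IsStarForest f) (s-isolated : IsolatedCentre f s) (s~t : s ~ t) where

    private
      s≢t : s ≢ t
      s≢t = ~⇒≢ s~t
      t≢s : t ≢ s
      t≢s = s≢t ∘ sym

    attachIsolated : Centre f t → Improvement f
    attachIsolated t-centre =
      f′ ,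
      update-starForest forest (proj₂ s-isolated) (λ _ → t-centre , s~t) ,
      size-≤-injective _ _ id id (update-centre⁻ t≢s) ,
      size-< _ _ s (λ y-isolated → update-isolatedCentre⁻ y-isolated (y≢s y-isolated)
                                     (y≢s y-isolated ∘ (λ y≡fs → trans y≡fs (proj₁ s-isolated))) ,
                                   y≢s y-isolated)
               s-isolated
      where
      f′ = update f s t
      y≢s : ∀ {y} → IsolatedCentre f′ y → y ≢ s
      y≢s (centre , _) refl = t≢s (trans (sym (update-≡ f _ t)) centre)

    moveLeaf : ¬ Centre f t → (∃ λ p → p ≢ t × p ≢ f t × f p ≡ f t) → Improvement f
    moveLeaf t-leaf (p , p≢t , p≢r , fp≡r) =
      f′ ,
      update-starForest forest (leaf⇒¬HasLeaf forest t-leaf) (λ _ → proj₁ s-isolated , ~-sym s~t) ,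
      size-≤-injective _ _ id id (update-centre⁻ s≢t) ,
      size-< _ _ s (λ y-isolated → update-isolatedCentre⁻ y-isolated (y≢t y-isolated) (y≢r y-isolated) ,
                                   y≢s y-isolated)
               s-isolated
      where
      f′ = update f t s
      y≢t : ∀ {y} → IsolatedCentre f′ y → y ≢ t
      y≢t (centre , _) refl = s≢t (trans (sym (update-≡ f _ s)) centre)
      y≢r : ∀ {y} → IsolatedCentre f′ y → y ≢ f t
      y≢r (_ , noLeaf) refl = noLeaf (p , p≢r , trans (update-≢ f s p≢t) fp≡r)
      y≢s : ∀ {y} → IsolatedCentre f′ y → y ≢ s
      y≢s (_ , noLeaf) refl = noLeaf (t , t≢s , update-≡ f t s)

  improvement-≤ : ∀ {f g} → centres g ≤ centres f → isolatedCentres g ≤ isolatedCentres f →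
                  Improvement g → Improvement f
  improvement-≤ centres≤ isolated≤ (h , forest , centres-h≤ , isolated-h<) =
    h , forest , ≤-trans centres-h≤ centres≤ , <-≤-trans isolated-h< isolated≤

  -- t becomes the centre of a star containing its old centre f t and s; on centres this
  -- acts as the transposition of t and f t.
  promoteLeaf : ∀ {f s t} → IsStarForest f → IsolatedCentre f s → s ~ t → ¬ Centre f t →
                (∀ p → p ≢ f t → f p ≡ f t → p ≡ t) → Improvement f
  promoteLeaf {f} {s} {t} forest s-isolated s~t t-leaf t-onlyLeaf =
    improvement-≤ (size-≤-injective _ _ (transpose t r) (transpose-injective t r) centre-transpose)
                  (size-≤-injective _ _ id id isolated⁻)
                  (attachIsolated forest₁ s-isolated₁ s~t t-centre₁)
    where
    r = f t
    f₀ = update f t t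
    f₁ = update f₀ r t
    t≢s : t ≢ s
    t≢s = ~⇒≢ s~t ∘ sym
    t≢r : t ≢ r
    t≢r = ~⇒≢ (proj₂ (forest t t-leaf))
    r≢t : r ≢ t
    r≢t = t≢r ∘ sym
    s≢r : s ≢ r
    s≢r s≡r = proj₂ s-isolated (t , t≢s , sym s≡r)
    r-centre : Centre f r
    r-centre = proj₁ (forest t t-leaf)
    forest₁ : IsStarForest f₁
    forest₁ = update-starForest
      (update-starForest forest (leaf⇒¬HasLeaf forest t-leaf) (λ t≢t → ⊥-elim (t≢t refl)))
      (λ (p , p≢r , f₀p≡r) → p≢t p≢r f₀p≡r (t-onlyLeaf p p≢r (trans (sym (update-≢ f t (p≢t p≢r f₀p≡r))) f₀p≡r)))
      (λ _ → update-≡ f t t , ~-sym (proj₂ (forest t t-leaf)))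
      where
      p≢t : ∀ {p} → p ≢ r → f₀ p ≡ r → p ≢ t
      p≢t _ f₀p≡r refl = t≢r (trans (sym (update-≡ f _ t)) f₀p≡r)
    t-centre₁ : Centre f₁ t
    t-centre₁ = trans (update-≢ f₀ t t≢r) (update-≡ f t t)
    s-isolated₁ : IsolatedCentre f₁ s
    s-isolated₁ = update-isolatedCentre⁺ (update-isolatedCentre⁺ s-isolated (t≢s ∘ sym) t≢s) s≢r t≢s
    centre-transpose : ∀ {y} → Centre f₁ y → Centre f (transpose t r y)
    centre-transpose {y} centre = by-cases (y ≟ t) (y ≟ r)
      where
      by-cases : Dec (y ≡ t) → Dec (y ≡ r) → Centre f (transpose t r y)
      by-cases (yes refl) _ = subst (Centre f) (sym (transpose-a t r)) r-centre
      by-cases (no _) (yes refl) = ⊥-elim (t≢r (trans (sym (update-≡ f₀ r t)) centre))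
      by-cases (no y≢t) (no y≢r) = subst (Centre f) (sym (transpose-≢ y≢t y≢r))
        (trans (sym (update-≢ f t y≢t)) (trans (sym (update-≢ f₀ t y≢r)) centre))
    isolated⁻ : ∀ {y} → IsolatedCentre f₁ y → IsolatedCentre f y
    isolated⁻ {y} y-isolated@(centre , noLeaf) =
      update-isolatedCentre⁻ (update-isolatedCentre⁻ y-isolated y≢r (y≢r ∘ (λ y≡f₀r → trans y≡f₀r f₀r≡r))) y≢t y≢r
      where
      y≢r : y ≢ r
      y≢r refl = t≢r (trans (sym (update-≡ f₀ y t)) centre)
      f₀r≡r : f₀ r ≡ r
      f₀r≡r = trans (update-≢ f t r≢t) r-centre
      y≢t : y ≢ t
      y≢t refl = noLeaf (r , r≢t , update-≡ f₀ r y)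

  improve : (∀ x → ∃ (x ~_)) → ∀ {f s} → IsStarForest f → IsolatedCentre f s → Improvement f
  improve neighbour {f} {s} forest s-isolated with neighbour s
  ... | t , s~t with f t ≟ t
  ... | yes t-centre = attachIsolated forest s-isolated s~t t-centre
  ... | no t-leaf with exists? (λ p → ¬? (p ≟ t) ×-dec (¬? (p ≟ f t) ×-dec (f p ≟ f t)))
  ... | yes otherLeaf = moveLeaf forest s-isolated s~t t-leaf otherLeaf
  ... | no noOtherLeaf = promoteLeaf forest s-isolated s~t t-leaf
    λ p p≢r fp≡r → decidable-stable (p ≟ t) (λ p≢t → noOtherLeaf (p , p≢t , p≢r , fp≡r))

  removeIsolatedCentres : (∀ x → ∃ (x ~_)) → ∀ {f} → IsStarForest f →
    ∃ λ f′ → IsStarForest f′ × centres f′ ≤ centres f × (∀ x → ¬ IsolatedCentre f′ x)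
  removeIsolatedCentres neighbour forest = go forest (<-wellFounded _)
    where
    go : ∀ {f} → IsStarForest f → Acc _<_ (isolatedCentres f) →
         ∃ λ f′ → IsStarForest f′ × centres f′ ≤ centres f × (∀ x → ¬ IsolatedCentre f′ x)
    go {f} forest (acc smaller) with exists? (isolatedCentre? f)
    ... | no none = f , forest , ≤-refl , λ x x-isolated → none (x , x-isolated)
    ... | yes (s , s-isolated) with improve neighbour forest s-isolated
    ... | f′ , forest′ , centres≤ , isolated< with go forest′ (smaller isolated<)
    ... | f″ , forest″ , centres≤′ , done = f″ , forest″ , ≤-trans centres≤′ centres≤ , done

  module _ (S : List V) (dominating : ∀ x → Any (λ s → x ≡ s ⊎ x ~ s) S) where

    private
      dominator : ∀ x → ∃ λ s → s ∈ S × (x ≡ s ⊎ x ∉ S × x ~ s)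
      dominator x with x ∈? S
      ... | yes x∈S = x , x∈S , inj₁ refl
      ... | no x∉S with find (dominating x)
      ... | s , s∈S , inj₁ refl = ⊥-elim (x∉S s∈S)
      ... | s , s∈S , inj₂ x~s = s , s∈S , inj₂ (x∉S , x~s)

      f : V → V
      f = proj₁ ∘ dominator

      f-∈ : ∀ x → f x ∈ S
      f-∈ x = proj₁ (proj₂ (dominator x))

      f-centre : ∀ {x} → x ∈ S → Centre f x
      f-centre {x} x∈S with proj₂ (proj₂ (dominator x))
      ... | inj₁ x≡fx = sym x≡fx
      ... | inj₂ (x∉S , _) = ⊥-elim (x∉S x∈S)

      f-forest : IsStarForest f
      f-forest x fx≢x with proj₂ (proj₂ (dominator x))
      ... | inj₁ x≡fx = ⊥-elim (fx≢x (sym x≡fx))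
      ... | inj₂ (_ , x~fx) = f-centre (f-∈ x) , x~fx

    dominatingSet⇒starForest : ∃ λ f → IsStarForest f × centres f ≤ length S
    dominatingSet⇒starForest =
      f , f-forest , size-≤-length _ S λ {x} fx≡x → subst (_∈ S) fx≡x (f-∈ x)

2≤m*n⇒2≤m⊎2≤n : ∀ m n → 2 ≤ m * n → 2 ≤ m ⊎ 2 ≤ n
2≤m*n⇒2≤m⊎2≤n (suc (suc _)) _ _ = inj₁ (s≤s (s≤s z≤n))
2≤m*n⇒2≤m⊎2≤n 1 n 2≤n = inj₂ (subst (2 ≤_) (*-identityˡ n) 2≤n)

Fin-neighbour : ∀ {k} → 2 ≤ k → (j : Fin k) → ∃ λ (j′ : Fin k) → Consecutive (toℕ j) (toℕ j′)
Fin-neighbour {suc zero} (s≤s ()) zero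
Fin-neighbour {suc (suc k)} _ zero = suc zero , inj₁ refl
Fin-neighbour {suc (suc k)} _ (suc j) = inject₁ j , inj₂ (cong suc (Fin.toℕ-inject₁ j))

module Board {m n : ℕ} where

  _≟_ : DecidableEquality (Cell m n)
  _≟_ = ≡-dec Fin._≟_ Fin._≟_

  open DecMembership _≟_ using (_∈?_)

  cells : List (Cell m n)
  cells = tabulate (remQuot {m} n)

  ∈-cells : ∀ c → c ∈ cells
  ∈-cells (i , j) = subst (_∈ cells) (Fin.remQuot-combine i j) (∈-tabulate⁺ (combine i j))

  cells-unique : Unique cells
  cells-unique = Unique.tabulate⁺ λ {i} {j} eq → begin
    i                             ≡⟨ Fin.combine-remQuot {m} n i ⟨
    uncurry combine (remQuot {m} n i) ≡⟨ cong (uncurry combine) eq ⟩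
    uncurry combine (remQuot {m} n j) ≡⟨ Fin.combine-remQuot {m} n j ⟩
    j                             ∎
    where open ≡-Reasoning

  length-cells : length cells ≡ m * n
  length-cells = length-tabulate (remQuot {m} n)

  Adjacent-sym : Symmetric (Adjacent {m} {n})
  Adjacent-sym (inj₁ (i≡i′ , j~j′)) = inj₁ (sym i≡i′ , swap j~j′)
  Adjacent-sym (inj₂ (j≡j′ , i~i′)) = inj₂ (sym j≡j′ , swap i~i′)

  Adjacent⇒≢ : ∀ {c c′ : Cell m n} → Adjacent c c′ → c ≢ c′
  Adjacent⇒≢ (inj₁ (_ , inj₁ j~j)) refl = 1+n≢n j~j
  Adjacent⇒≢ (inj₁ (_ , inj₂ j~j)) refl = 1+n≢n j~j
  Adjacent⇒≢ (inj₂ (_ , inj₁ i~i)) refl = 1+n≢n i~i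
  Adjacent⇒≢ (inj₂ (_ , inj₂ i~i)) refl = 1+n≢n i~i

  neighbour : 2 ≤ m * n → (c : Cell m n) → ∃ (Adjacent c)
  neighbour 2≤mn (i , j) with 2≤m*n⇒2≤m⊎2≤n m n 2≤mn
  ... | inj₁ 2≤m = let (i′ , i~i′) = Fin-neighbour 2≤m i in (i′ , j) , inj₂ (refl , i~i′)
  ... | inj₂ 2≤n = let (j′ , j~j′) = Fin-neighbour 2≤n j in (i , j′) , inj₁ (refl , j~j′)

  open StarForests _≟_ cells ∈-cells cells-unique Adjacent Adjacent-sym Adjacent⇒≢ public

  partner : ∀ {c} (d : Domino m n) → c ∈D d → ∃ λ c′ → c′ ∈D d × Adjacent c c′
  partner ((a , b) , a~b) (inj₁ refl) = b , inj₂ refl , a~b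
  partner ((a , b) , a~b) (inj₂ refl) = a , inj₁ refl , Adjacent-sym a~b

  module _ {D : List (Domino m n)} (saturated : IsSaturated D) where

    privateCell : Fin (length D) → Cell m n
    privateCell k = proj₁ (proj₂ saturated k)

    privateCell-only : ∀ j k → privateCell k ∈D lookup D j → j ≡ k
    privateCell-only j k c∈ with j Fin.≟ k
    ... | yes j≡k = j≡k
    ... | no j≢k = ⊥-elim (proj₂ (proj₂ saturated k) (Any-removeAt⁺ D c∈ j≢k))

    privateCell-∈ : ∀ k → privateCell k ∈D lookup D k
    privateCell-∈ k = subst (λ j → privateCell k ∈D lookup D j) (privateCell-only _ k c∈) c∈
      where c∈ = lookup-index (proj₁ saturated (privateCell k))

    privateCells : List (Cell m n)
    privateCells = tabulate privateCell

    privateCells-unique : Unique privateCells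
    privateCells-unique = Unique.tabulate⁺ λ {i} {j} eq →
      privateCell-only i j (subst (_∈D lookup D i) eq (privateCell-∈ i))

    sharedCells : List (Cell m n)
    sharedCells = filter (λ c → ¬? (c ∈? privateCells)) cells

    sharedCells-dominating : IsDominating sharedCells
    sharedCells-dominating = Unique.filter⁺ _ cells-unique , dominated
      where
      shared : ∀ {c} → c ∉ privateCells → c ∈ sharedCells
      shared {c} = ∈-filter⁺ (λ c → ¬? (c ∈? privateCells)) (∈-cells c)
      dominated : ∀ c → Any (λ s → c ≡ s ⊎ Adjacent c s) sharedCells
      dominated c with c ∈? privateCells
      ... | no c∉ = lose (shared c∉) (inj₁ refl)
      ... | yes c∈ with ∈-tabulate⁻ c∈
      ... | k , refl with partner (lookup D k) (privateCell-∈ k)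
      ... | c′ , c′∈d , c~c′ = lose (shared c′∉) (inj₂ c~c′)
        where
        c′∉ : c′ ∉ privateCells
        c′∉ c′∈ with ∈-tabulate⁻ c′∈
        ... | j , refl with privateCell-only k j c′∈d
        ... | refl = Adjacent⇒≢ c~c′ refl

    length+shared≤ : length D + length sharedCells ≤ m * n
    length+shared≤ = begin
      length D + length sharedCells                 ≡⟨ cong (_+ length sharedCells) (length-tabulate privateCell) ⟨
      length privateCells + length sharedCells      ≡⟨ length-++ privateCells ⟨
      length (privateCells ++ sharedCells)          ≤⟨ Unique⇒length≤ unique (λ {c} _ → ∈-cells c) ⟩
      length cells                                  ≡⟨ length-cells ⟩
      m * n                                         ∎
      where
      open ≤-Reasoning
      unique : Unique (privateCells ++ sharedCells)
      unique = Unique.++⁺ privateCells-unique (proj₁ sharedCells-dominating)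
        λ (c∈p , c∈s) → proj₂ (∈-filter⁻ (λ c → ¬? (c ∈? privateCells)) {xs = cells} c∈s) c∈p

  saturated-length≤ : ∀ {g} → (∀ S → IsDominating S → g ≤ length S) →
                      ∀ D → IsSaturated D → length D ≤ m * n ∸ g
  saturated-length≤ {g} minimal D saturated = m+n≤o⇒m≤o∸n (length D) (begin
    length D + g                     ≤⟨ +-monoʳ-≤ (length D) (minimal _ (sharedCells-dominating saturated)) ⟩
    length D + length (sharedCells saturated) ≤⟨ length+shared≤ saturated ⟩
    m * n                            ∎)
    where open ≤-Reasoning

  module _ {f : Cell m n → Cell m n} (forest : IsStarForest f) where

    leafDomino : (c : Cell m n) → ¬ Centre f c → Domino m n
    leafDomino c c-leaf = (c , f c) , proj₂ (forest c c-leaf)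

    leafDominoes : List (Cell m n) → List (Domino m n)
    leafDominoes [] = []
    leafDominoes (c ∷ cs) with f c ≟ c
    ... | yes _ = leafDominoes cs
    ... | no c-leaf = leafDomino c c-leaf ∷ leafDominoes cs

    length-leafDominoes : ∀ cs → length (leafDominoes cs) + length (filter (λ c → f c ≟ c) cs) ≡ length cs
    length-leafDominoes [] = refl
    length-leafDominoes (c ∷ cs) with f c ≟ c
    ... | yes _ = trans (+-suc _ _) (cong suc (length-leafDominoes cs))
    ... | no _ = cong suc (length-leafDominoes cs)

    leafDominoes-covers : ∀ {cs p x} → p ∈ cs → ¬ Centre f p → x ≡ p ⊎ x ≡ f p → Covered (leafDominoes cs) x
    leafDominoes-covers {c ∷ cs} (here refl) p-leaf x∈d with f c ≟ c
    ... | yes p-centre = ⊥-elim (p-leaf p-centre)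
    ... | no _ = here x∈d
    leafDominoes-covers {c ∷ cs} (there p∈cs) p-leaf x∈d with f c ≟ c
    ... | yes _ = leafDominoes-covers p∈cs p-leaf x∈d
    ... | no _ = there (leafDominoes-covers p∈cs p-leaf x∈d)

    leaf∈leafDomino⇒≡ : ∀ {c p} (p-leaf : ¬ Centre f p) → ¬ Centre f c → c ∈D leafDomino p p-leaf → c ≡ p
    leaf∈leafDomino⇒≡ _ _ (inj₁ c≡p) = c≡p
    leaf∈leafDomino⇒≡ p-leaf c-leaf (inj₂ c≡fp) =
      ⊥-elim (c-leaf (subst (Centre f) (sym c≡fp) (proj₁ (forest _ p-leaf))))

    leaf-uncovered : ∀ {c} cs → ¬ Centre f c → c ∉ cs → ¬ Covered (leafDominoes cs) c
    leaf-uncovered (p ∷ ps) c-leaf c∉ covered with f p ≟ p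
    ... | yes _ = leaf-uncovered ps c-leaf (c∉ ∘ there) covered
    ... | no p-leaf with covered
    ... | here c∈d = c∉ (here (leaf∈leafDomino⇒≡ p-leaf c-leaf c∈d))
    ... | there covered′ = leaf-uncovered ps c-leaf (c∉ ∘ there) covered′

    leafDominoes-private : ∀ cs → Unique cs → (k : Fin (length (leafDominoes cs))) →
      ∃ λ c → c ∈ cs × ¬ Centre f c × ¬ Covered (removeAt (leafDominoes cs) k) c
    leafDominoes-private (c ∷ cs) (c∉cs ∷ cs!) k with f c ≟ c
    ... | yes _ = let (c′ , c′∈ , c′-leaf , uncovered) = leafDominoes-private cs cs! k
                  in c′ , there c′∈ , c′-leaf , uncovered
    leafDominoes-private (c ∷ cs) (c∉cs ∷ cs!) zero | no c-leaf =
      c , here refl , c-leaf , leaf-uncovered cs c-leaf (λ c∈ → All.lookup c∉cs c∈ refl)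
    leafDominoes-private (c ∷ cs) (c∉cs ∷ cs!) (suc k) | no c-leaf
      with leafDominoes-private cs cs! k
    ... | c′ , c′∈ , c′-leaf , uncovered = c′ , there c′∈ , c′-leaf , λ where
      (here c′∈d) → All.lookup c∉cs c′∈ (sym (leaf∈leafDomino⇒≡ c-leaf c′-leaf c′∈d))
      (there covered) → uncovered covered

    starForest⇒saturated : (∀ c → ¬ IsolatedCentre f c) →
                           ∃ λ D → IsSaturated D × length D ≡ m * n ∸ centres f
    starForest⇒saturated noIsolated =
      leafDominoes cells ,
      (covering , λ k → let (c , _ , _ , uncovered) = leafDominoes-private cells cells-unique k in c , uncovered) ,
      (begin
        length (leafDominoes cells)                 ≡⟨ m+n∸n≡m _ (centres f) ⟨
        length (leafDominoes cells) + centres f ∸ centres f ≡⟨ cong (_∸ centres f) (length-leafDominoes cells) ⟩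
        length cells ∸ centres f                    ≡⟨ cong (_∸ centres f) length-cells ⟩
        m * n ∸ centres f                           ∎)
      where
      open ≡-Reasoning
      covering : IsCovering (leafDominoes cells)
      covering c with f c ≟ c
      ... | no c-leaf = leafDominoes-covers (∈-cells c) c-leaf (inj₁ refl)
      ... | yes c-centre with hasLeaf? f c
      ... | no noLeaf = ⊥-elim (noIsolated c (c-centre , noLeaf))
      ... | yes (p , p≢c , fp≡c) =
        leafDominoes-covers (∈-cells p) (λ fp≡p → p≢c (trans (sym fp≡p) fp≡c)) (inj₂ (sym fp≡c))

open Board

mainTheorem16 : (m n : ℕ) → 2 ≤ m * n → (g : ℕ) → IsDominationNumber m n g →
    IsMaxSaturatedSize m n (m * n ∸ g)
mainTheorem16 m n 2≤mn g ((S , (_ , dominating) , |S|≡g) , minimal)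
  with dominatingSet⇒starForest S dominating
... | f₀ , forest₀ , centres-f₀≤|S|
  with removeIsolatedCentres (neighbour {m} {n} 2≤mn) forest₀
... | f , forest , centres-f≤f₀ , noIsolated
  with starForest⇒saturated forest noIsolated
... | D , saturated , |D|≡ =
  (D , saturated , ≤-antisym (saturated-length≤ minimal D saturated) (begin
    m * n ∸ g          ≤⟨ ∸-monoʳ-≤ (m * n) (≤-trans centres-f≤f₀ (subst (centres f₀ ≤_) |S|≡g centres-f₀≤|S|)) ⟩
    m * n ∸ centres f  ≡⟨ |D|≡ ⟨
    length D           ∎)) ,
  saturated-length≤ minimal
  where open ≤-Reasoning
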